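{- Let $\mathcal A$ be the admissible evolution of execution for a finite dag $\mathcal G$ with node set $N$. Then $\mathcal A$ is a dag; its nodes are exactly the subsets of $N$ that satisfy precedence constraints; it has a single source, $\emptyset$, and a single sink, $N$.
   Context: Let $\mathcal G$ be a finite dag with node set $N$. A set $X\subseteq N$ satisfies precedence constraints if every parent (in $\mathcal G$) of every node in $X$ belongs to $X$. For $X\subseteq N$, $E(X)$ denotes the set of nodes not in $X$ all of whose parents lie in $X$. The admissible evolution of execution $\mathcal A$ is the directed graph whose nodes are subsets of $N$, built inductively: start with the single node $\emptyset$; for every node $X$ already present that does not contain every sink of $\mathcal G$, and for every nonempty $D\subseteq E(X)$, add the node $X\cup D$ (if not already present) and the arc $(X\to X\cup D)$ (if not already present). $\mathcal A$ is the resulting (finite) directed graph. -}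

module Defs where

open import Data.Nat using (ℕ)
open import Data.Fin using (Fin)
open import Data.Bool using (Bool; T)
open import Data.Fin.Subset using (Subset; _∈_; _∉_; _⊆_; _∪_; Nonempty) public
open import Data.Empty using (⊥)
open import Relation.Nullary using (¬_)
open import Relation.Binary.Construct.Closure.Transitive using (TransClosure)

-- A finite directed graph on node set N = Fin n; edge u v = true means arc u → v,
-- i.e. u is a parent of v.
record Digraph (n : ℕ) : Set where
  field
    edge : Fin n → Fin n → Bool

module _ {n : ℕ} (G : Digraph n) where
  open Digraph G

  Arrow : Fin n → Fin n → Set
  Arrow u v = T (edge u v)

  IsDag : Set
  IsDag = ∀ x → ¬ TransClosure Arrow x x

  Precedence : Subset n → Set
  Precedence X = ∀ u v → Arrow u v → v ∈ X → u ∈ X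

  IsSink : Fin n → Set
  IsSink v = ∀ w → ¬ Arrow v w

  ContainsAllSinks : Subset n → Set
  ContainsAllSinks X = ∀ v → IsSink v → v ∈ X

  InE : Subset n → Fin n → Set
  InE X v = v ∉ X × (∀ u → Arrow u v → u ∈ X)
    where open import Data.Product using (_×_)

  -- The admissible evolution of execution 𝒜, as the inductively generated
  -- node set and arc set.
  data ANode : Subset n → Set
  data AArc : Subset n → Subset n → Set

  data ANode where
    root : ANode Data.Fin.Subset.⊥
    grow : ∀ {X Y} → AArc X Y → ANode Y

  data AArc where
    step : ∀ {X} (D : Subset n) → ANode X → ¬ ContainsAllSinks X →
           (∀ v → v ∈ D → InE X v) → Nonempty D → AArc X (X ∪ D)

  AIsDag : Set
  AIsDag = ∀ X → ¬ TransClosure AArc X X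

  ASource : Subset n → Set
  ASource X = ANode X × (∀ Y → ¬ AArc Y X)
    where open import Data.Product using (_×_)

  ASink : Subset n → Set
  ASink X = ANode X × (∀ Y → ¬ AArc X Y)
    where open import Data.Product using (_×_)

-- Each arc adds only nodes whose parents are already present, so reachable sets are
-- closed under parents; and arcs strictly enlarge sets, so the evolution is acyclic.
-- Conversely, a nonempty parent-closed X has a node v without children in X (G is
-- acyclic and finite), X - v is again parent-closed, and X is reached from X - v by
-- the arc adding v; induction on |X| does the rest. A parent-closed set containing
-- every sink is all of N, so every reachable X ≠ N has an outgoing arc: add a node
-- outside X all of whose parents lie in X.
module Submission where

open import Defs
open import Data.Nat using (ℕ)
open import Data.Fin.Subset using (Subset; ⊥; ⊤)
open import Data.Product using (_×_)
open import Function.Bundles using (_⇔_)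
open import Relation.Binary.PropositionalEquality using (_≡_)

open import Data.Bool using (T?)
open import Data.Empty using (⊥-elim)
open import Data.Fin using (Fin; _≟_)
open import Data.Fin.Induction using (spo-wellFounded; spo-noetherian)
open import Data.Fin.Properties using (any?)
open import Data.Fin.Subset using (⁅_⁆; _-_; _─_; ∣_∣; _⊂_)
open import Data.Fin.Subset.Properties
  using (_∈?_; ∈⊤; ⊆⊤; ∉⊥; x∈⁅x⁆; x∈⁅y⁆⇒x≡y; ⊆-antisym; ⊂-trans; ⊂-irref; p⊆p∪q;
         x∈p∪q⁺; x∈p∪q⁻; p─q⊆p; x∈p∧x≢y⇒x∈p-y; x∈p⇒∣p-x∣<∣p∣; nonempty?; Empty-unique)
open import Data.Nat.Induction using (<-wellFounded)
open import Data.Product using (∃; _,_; proj₁; proj₂)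
open import Data.Sum using (inj₁; inj₂)
open import Data.Vec using (_∷_; there)
open import Function using (flip; _on_; _∘_)
open import Function.Bundles using (mk⇔)
open import Induction.WellFounded using (WellFounded; Acc; acc; module Subrelation)
open import Level using (Level)
open import Relation.Binary using (Rel; Decidable; IsStrictPartialOrder)
open import Relation.Binary.Construct.Closure.Transitive using (TransClosure; [_]; _∷_; _++_)
import Relation.Binary.Construct.On as On
open import Relation.Binary.PropositionalEquality using (refl; subst; resp₂; isEquivalence)
open import Relation.Nullary using (¬_; yes; no; ¬?)
open import Relation.Nullary.Decidable using (_×-dec_; decidable-stable)
open import Relation.Unary using (Pred)
import Relation.Unary as U
import Data.Nat as ℕ

private
  variable
    ℓ p : Level
    n : ℕ

module _ {R : Rel (Fin n) ℓ} (acyclic : ∀ x → ¬ TransClosure R x x) where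

  transClosure-isStrictPartialOrder : IsStrictPartialOrder _≡_ (TransClosure R)
  transClosure-isStrictPartialOrder = record
    { isEquivalence = isEquivalence
    ; irrefl        = λ { refl → acyclic _ }
    ; trans         = _++_
    ; <-resp-≈      = resp₂ (TransClosure R)
    }

  acyclic⇒wellFounded : WellFounded R
  acyclic⇒wellFounded =
    Subrelation.wellFounded [_] (spo-wellFounded transClosure-isStrictPartialOrder)

  acyclic⇒noetherian : WellFounded (flip R)
  acyclic⇒noetherian =
    Subrelation.wellFounded [_] (spo-noetherian transClosure-isStrictPartialOrder)

module _ {_<_ : Rel (Fin n) ℓ} (_<?_ : Decidable _<_) (wf : WellFounded _<_)
         {P : Pred (Fin n) p} (P? : U.Decidable P) where

  ∃-minimal : ∀ {x} → P x → ∃ λ m → P m × (∀ y → y < m → ¬ P y)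
  ∃-minimal {x} = go (wf x)
    where
    go : ∀ {x} → Acc _<_ x → P x → ∃ λ m → P m × (∀ y → y < m → ¬ P y)
    go {x} (acc smaller) Px with any? (λ y → (y <? x) ×-dec P? y)
    ... | yes (y , y<x , Py) = go (smaller y<x) Py
    ... | no none            = x , Px , λ y y<x Py → none (y , y<x , Py)

x∈p─q⇒x∉q : ∀ {x : Fin n} (p q : Subset n) → x ∈ p ─ q → x ∉ q
x∈p─q⇒x∉q (_ ∷ p) (_ ∷ q) (there x∈p─q) (there x∈q) = x∈p─q⇒x∉q p q x∈p─q x∈q

x∈p⇒p-x∪⁅x⁆≡p : ∀ {x : Fin n} {p : Subset n} → x ∈ p → (p - x) ∪ ⁅ x ⁆ ≡ p
x∈p⇒p-x∪⁅x⁆≡p {x = x} {p} x∈p = ⊆-antisym ⊆p ⊇p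
  where
  ⊆p : (p - x) ∪ ⁅ x ⁆ ⊆ p
  ⊆p y∈ with x∈p∪q⁻ (p - x) ⁅ x ⁆ y∈
  ... | inj₁ y∈p-x = p─q⊆p p ⁅ x ⁆ y∈p-x
  ... | inj₂ y∈⁅x⁆ with refl ← x∈⁅y⁆⇒x≡y x y∈⁅x⁆ = x∈p
  ⊇p : p ⊆ (p - x) ∪ ⁅ x ⁆
  ⊇p {y} y∈p with y ≟ x
  ... | yes refl = x∈p∪q⁺ (inj₂ (x∈⁅x⁆ x))
  ... | no y≢x   = x∈p∪q⁺ (inj₁ (x∈p∧x≢y⇒x∈p-y y∈p y≢x))

module _ (G : Digraph n) where

  ANode⇒Precedence : ∀ {X} → ANode G X → Precedence G X
  ANode⇒Precedence root u v u⟶v v∈⊥ = ⊥-elim (∉⊥ v∈⊥)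
  ANode⇒Precedence (grow (step {X} D reached _ new _)) u v u⟶v v∈X∪D with x∈p∪q⁻ X D v∈X∪D
  ... | inj₁ v∈X = x∈p∪q⁺ (inj₁ (ANode⇒Precedence reached u v u⟶v v∈X))
  ... | inj₂ v∈D = x∈p∪q⁺ (inj₁ (proj₂ (new v v∈D) u u⟶v))

  AArc⇒⊂ : ∀ {X Y} → AArc G X Y → X ⊂ Y
  AArc⇒⊂ (step {X} D _ _ new (w , w∈D)) = p⊆p∪q D , w , x∈p∪q⁺ (inj₂ w∈D) , proj₁ (new w w∈D)

  AArc⁺⇒⊂ : ∀ {X Y} → TransClosure (AArc G) X Y → X ⊂ Y
  AArc⁺⇒⊂ [ X→Y ]       = AArc⇒⊂ X→Y
  AArc⁺⇒⊂ (X→Y ∷ Y→⁺Z) = ⊂-trans (AArc⇒⊂ X→Y) (AArc⁺⇒⊂ Y→⁺Z)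

  AArc-acyclic : AIsDag G
  AArc-acyclic X X→⁺X = ⊂-irref refl (AArc⁺⇒⊂ X→⁺X)

  ASource⇔≡⊥ : ∀ X → ASource G X ⇔ X ≡ ⊥
  ASource⇔≡⊥ _ = mk⇔ to from
    where
    to : ∀ {X} → ASource G X → X ≡ ⊥
    to (root , _)           = refl
    to (grow Y→X , noneIn) = ⊥-elim (noneIn _ Y→X)
    from : ∀ {X} → X ≡ ⊥ → ASource G X
    from refl = root , λ Y Y→⊥ → let (_ , _ , v∈⊥ , _) = AArc⇒⊂ Y→⊥ in ∉⊥ v∈⊥

module _ (G : Digraph n) (dag : IsDag G) where

  private
    _⟶_ : Fin n → Fin n → Set
    _⟶_ = Arrow G

    _⟶?_ : Decidable _⟶_
    u ⟶? v = T? (Digraph.edge G u v)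

  ∃-childless-∉ : ∀ {X w} → w ∉ X → ∃ λ v → v ∉ X × (∀ c → v ⟶ c → c ∈ X)
  ∃-childless-∉ {X} w∉X
    with v , v∉X , childrenIn ← ∃-minimal (flip _⟶?_) (acyclic⇒noetherian dag) (¬? ∘ (_∈? X)) w∉X
    = v , v∉X , λ c v⟶c → decidable-stable (c ∈? X) (childrenIn c v⟶c)

  ∃-orphan-∉ : ∀ {X w} → w ∉ X → ∃ λ v → v ∉ X × (∀ u → u ⟶ v → u ∈ X)
  ∃-orphan-∉ {X} w∉X
    with v , v∉X , parentsIn ← ∃-minimal _⟶?_ (acyclic⇒wellFounded dag) (¬? ∘ (_∈? X)) w∉X
    = v , v∉X , λ u u⟶v → decidable-stable (u ∈? X) (parentsIn u u⟶v)

  ∃-childless-∈ : ∀ {X w} → w ∈ X → ∃ λ v → v ∈ X × (∀ c → v ⟶ c → c ∉ X)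
  ∃-childless-∈ {X} = ∃-minimal (flip _⟶?_) (acyclic⇒noetherian dag) (_∈? X)

  precedence∧sinks⇒⊤ : ∀ {X} → Precedence G X → ContainsAllSinks G X → X ≡ ⊤
  precedence∧sinks⇒⊤ {X} closed sinks = ⊆-antisym ⊆⊤ λ {w} _ → decidable-stable (w ∈? X) not-∉
    where
    not-∉ : ∀ {w} → ¬ w ∉ X
    not-∉ w∉X with v , v∉X , childrenIn ← ∃-childless-∉ w∉X with any? (v ⟶?_)
    ... | yes (c , v⟶c) = v∉X (closed v c v⟶c (childrenIn c v⟶c))
    ... | no childless  = v∉X (sinks v λ c v⟶c → childless (c , v⟶c))

  AArc-⁅⁆ : ∀ {X v} → ANode G X → v ∉ X → (∀ u → u ⟶ v → u ∈ X) → AArc G X (X ∪ ⁅ v ⁆)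
  AArc-⁅⁆ {X} {v} reached v∉X parentsIn = step ⁅ v ⁆ reached missesSink new (v , x∈⁅x⁆ v)
    where
    missesSink : ¬ ContainsAllSinks G X
    missesSink sinks with refl ← precedence∧sinks⇒⊤ (ANode⇒Precedence G reached) sinks = v∉X ∈⊤
    new : ∀ u → u ∈ ⁅ v ⁆ → InE G X u
    new u u∈⁅v⁆ with refl ← x∈⁅y⁆⇒x≡y v u∈⁅v⁆ = v∉X , parentsIn

  parent∈-minus-childless : ∀ {X u v w} → Precedence G X → (∀ c → v ⟶ c → c ∉ X) →
                            u ⟶ w → w ∈ X → u ∈ X - v
  parent∈-minus-childless closed childless u⟶w w∈X =
    x∈p∧x≢y⇒x∈p-y (closed _ _ u⟶w w∈X) λ { refl → childless _ u⟶w w∈X }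

  Precedence⇒ANode : ∀ {X} → Precedence G X → ANode G X
  Precedence⇒ANode {X} = go (On.wellFounded ∣_∣ <-wellFounded X)
    where
    go : ∀ {X} → Acc (ℕ._<_ on ∣_∣) X → Precedence G X → ANode G X
    go {X} (acc smaller) closed with nonempty? X
    ... | no empty with refl ← Empty-unique empty = root
    ... | yes (w , w∈X) with v , v∈X , childless ← ∃-childless-∈ w∈X
      = subst (ANode G) (x∈p⇒p-x∪⁅x⁆≡p v∈X) (grow (AArc-⁅⁆ reached v∉X-v parentsIn))
      where
      reached : ANode G (X - v)
      reached = go (smaller (x∈p⇒∣p-x∣<∣p∣ v∈X))
        λ u c u⟶c c∈X-v → parent∈-minus-childless closed childless u⟶c (p─q⊆p X ⁅ v ⁆ c∈X-v)
      v∉X-v : v ∉ X - v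
      v∉X-v v∈X-v = x∈p─q⇒x∉q X ⁅ v ⁆ v∈X-v (x∈⁅x⁆ v)
      parentsIn : ∀ u → u ⟶ v → u ∈ X - v
      parentsIn u u⟶v = parent∈-minus-childless closed childless u⟶v v∈X

  ∉⇒∃-AArc : ∀ {X w} → ANode G X → w ∉ X → ∃ (AArc G X)
  ∉⇒∃-AArc reached w∉X with v , v∉X , parentsIn ← ∃-orphan-∉ w∉X =
    _ , AArc-⁅⁆ reached v∉X parentsIn

  ASink⇔≡⊤ : ∀ X → ASink G X ⇔ X ≡ ⊤
  ASink⇔≡⊤ _ = mk⇔ to from
    where
    to : ∀ {X} → ASink G X → X ≡ ⊤
    to {X} (reached , noneOut) =
      ⊆-antisym ⊆⊤ λ {w} _ →
        decidable-stable (w ∈? X) λ w∉X → noneOut _ (proj₂ (∉⇒∃-AArc reached w∉X))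
    from : ∀ {X} → X ≡ ⊤ → ASink G X
    from refl = Precedence⇒ANode (λ _ _ _ _ → ∈⊤)
              , λ { _ (step _ _ missesSink _ _) → missesSink λ _ _ → ∈⊤ }

lemma3p1 : ∀ {n : ℕ} (G : Digraph n) → IsDag G →
    AIsDag G
    × (∀ (X : Subset n) → ANode G X ⇔ Precedence G X)
    × (∀ (X : Subset n) → ASource G X ⇔ X ≡ ⊥)
    × (∀ (X : Subset n) → ASink G X ⇔ X ≡ ⊤)
lemma3p1 G dag =
    AArc-acyclic G
  , (λ X → mk⇔ (ANode⇒Precedence G) (Precedence⇒ANode G dag))
  , ASource⇔≡⊥ G
  , ASink⇔≡⊤ G dag
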